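{- Let $p$ be a prime, $n,m\in\mathbb{N}$, $0\le i\le n$, and let $M_1,M_2$ be $R_mG_i$-submodules of a common $R_mG_i$-module. If $M_1^\star\cap M_2^\star=\{0\}$, then $M_1+M_2=M_1\oplus M_2$.
   Context: $G$ is cyclic of order $p^n$ with generator $\sigma$; $G_i$ its quotient of order $p^i$; $R_m=\mathbb{Z}/p^m\mathbb{Z}$. For a module $M$, $M^\star=\{x\in M: px=0,\ (\sigma-1)x=0\}$. -}

module Defs where

open import Level using (Level; _⊔_) renaming (suc to lsuc)
open import Data.Nat using (ℕ; zero; suc; _^_)
open import Algebra.Bundles using (AbelianGroup)
open import Relation.Unary using (Pred; _∈_)
open import Relation.Binary.Core using (Rel)
open import Function using (_∘_)

module _ {c ℓ} (A : AbelianGroup c ℓ) where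
  open AbelianGroup A

  times : ℕ → Carrier → Carrier
  times zero    x = ε
  times (suc k) x = x ∙ times k x

iter : ∀ {a} {X : Set a} → (X → X) → ℕ → X → X
iter f zero    x = x
iter f (suc k) x = f (iter f k x)

-- A module over the group ring R_m G_i, where R_m = ℤ/p^m ℤ and G_i is
-- cyclic of order p^i generated by (the image of) σ.  Such a module is
-- exactly an abelian group killed by p^m together with an additive
-- endomorphism σ satisfying σ^(p^i) = id.
record RmGiModule (p m i : ℕ) (c ℓ : Level) : Set (lsuc (c ⊔ ℓ)) where
  field
    abGroup : AbelianGroup c ℓ
  open AbelianGroup abGroup public
  field
    σ        : Carrier → Carrier
    σ-cong   : ∀ {x y} → x ≈ y → σ x ≈ σ y
    σ-hom    : ∀ x y → σ (x ∙ y) ≈ σ x ∙ σ y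
    σ-order  : ∀ x → iter σ (p ^ i) x ≈ x
    char     : ∀ x → times abGroup (p ^ m) x ≈ ε

record IsSubmodule {p m i c ℓ r} (M : RmGiModule p m i c ℓ)
                   (N : Pred (RmGiModule.Carrier M) r) : Set (c ⊔ ℓ ⊔ r) where
  open RmGiModule M
  field
    resp-≈ : ∀ {x y} → x ≈ y → x ∈ N → y ∈ N
    ε-mem  : ε ∈ N
    ∙-mem  : ∀ {x y} → x ∈ N → y ∈ N → (x ∙ y) ∈ N
    ⁻¹-mem : ∀ {x} → x ∈ N → (x ⁻¹) ∈ N
    σ-mem  : ∀ {x} → x ∈ N → σ x ∈ N

star : ∀ {p m i c ℓ r} (M : RmGiModule p m i c ℓ) →
       Pred (RmGiModule.Carrier M) r → Pred (RmGiModule.Carrier M) (ℓ ⊔ r)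
star {p} M N x = x ∈ N × (times abGroup p x ≈ ε) × (σ x ≈ x)
  where open RmGiModule M
        open import Data.Product using (_×_)

IsDirectSum : ∀ {p m i c ℓ r} (M : RmGiModule p m i c ℓ) →
              (N₁ N₂ : Pred (RmGiModule.Carrier M) r) → Set (c ⊔ ℓ ⊔ r)
IsDirectSum M N₁ N₂ = ∀ x → x ∈ N₁ → x ∈ N₂ → x ≈ ε
  where open RmGiModule M

-- It suffices that a submodule N = M₁ ∩ M₂ with N^⋆ = 0 vanishes.  On its p-torsion the
-- binomial theorem in characteristic p gives (σ − 1)^(p^i) = σ^(p^i) − 1 = 0; since σ − 1
-- has trivial kernel on N[p] (that kernel is N^⋆), so has its power, and N[p] = 0.  Then
-- multiplication by p has trivial kernel on N, and so has p^m, which is zero: N = 0.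

module Submission where

open import Level using (Level; _⊔_)
open import Data.Nat as ℕ using (ℕ; zero; suc; _<_; _≤_; _∸_; s≤s; z≤n)
open import Data.Nat.Properties using (n∸n≡0; *-comm)
open import Data.Nat.Combinatorics using (_C_; nCn≡1)
open import Data.Nat.Divisibility using (_∣_; divides)
open import Data.Nat.Primality using (Prime; ¬prime[0])
import Data.Fin as Fin
open import Data.Fin.Properties using (inject₁ℕ<; toℕ-fromℕ)
open import Data.Vec.Functional using (tail; init; last)
open import Data.Product using (_,_)
open import Relation.Nullary using (contradiction)
open import Relation.Unary using (Pred; _∈_; _∩_)
open import Relation.Binary.Core using (Rel)
import Relation.Binary.PropositionalEquality as ≡
open ≡ using (_≡_)
open import Algebra.Bundles using (Semiring; AbelianGroup)
import Algebra.Properties.Semiring.Binomial as Binomial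
open import Defs

module BinomialCoefficients where
  open import Data.Nat using (_+_; _*_)
  open import Data.Nat.Properties using (<⇒≱; +-identityʳ; *-identityʳ)
  open import Data.Nat.Combinatorics using (k>n⇒nCk≡0; nC1≡n)
    renaming (nCk+nC[k+1]≡[n+1]C[k+1] to pascal)
  open import Data.Nat.Divisibility using (∣⇒≤)
  open import Data.Nat.Primality using (euclidsLemma)
  open import Data.Nat.Tactic.RingSolver using (solve-∀)
  open import Data.Sum using (inj₁; inj₂)

  [k+1]*[n+1]C[k+1]≡[n+1]*nCk : ∀ n k → suc k * (suc n C suc k) ≡ suc n * (n C k)
  [k+1]*[n+1]C[k+1]≡[n+1]*nCk zero    zero    = ≡.refl
  [k+1]*[n+1]C[k+1]≡[n+1]*nCk zero    (suc k) rewrite k>n⇒nCk≡0 {0} {suc k} (s≤s z≤n) = *-comm (suc (suc k)) 0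
  [k+1]*[n+1]C[k+1]≡[n+1]*nCk (suc n) zero    rewrite nC1≡n (suc (suc n)) = ≡.trans (+-identityʳ _) (≡.sym (*-identityʳ _))
  [k+1]*[n+1]C[k+1]≡[n+1]*nCk (suc n) (suc k) = begin
    (2 + k) * (suc (suc n) C suc (suc k)) ≡⟨ ≡.cong ((2 + k) *_) (pascal (suc n) (suc k)) ⟨
    (2 + k) * (a + b)                      ≡⟨ regroupₗ k a b ⟩
    (1 + k) * a + a + (2 + k) * b          ≡⟨ ≡.cong₂ (λ u v → u + a + v) ([k+1]*[n+1]C[k+1]≡[n+1]*nCk n k) ([k+1]*[n+1]C[k+1]≡[n+1]*nCk n (suc k)) ⟩
    (1 + n) * c + a + (1 + n) * d          ≡⟨ ≡.cong (λ u → (1 + n) * c + u + (1 + n) * d) (≡.sym (pascal n k)) ⟩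
    (1 + n) * c + (c + d) + (1 + n) * d    ≡⟨ regroupᵣ n c d ⟩
    (2 + n) * (c + d)                      ≡⟨ ≡.cong ((2 + n) *_) (pascal n k) ⟩
    (2 + n) * a                            ∎
    where
    open ≡.≡-Reasoning
    a b c d : ℕ
    a = suc n C suc k
    b = suc n C suc (suc k)
    c = n C k
    d = n C suc k
    regroupₗ : ∀ k a b → (2 + k) * (a + b) ≡ (1 + k) * a + a + (2 + k) * b
    regroupₗ = solve-∀
    regroupᵣ : ∀ n c d → (1 + n) * c + (c + d) + (1 + n) * d ≡ (2 + n) * (c + d)
    regroupᵣ = solve-∀

  prime∣pCk : ∀ {p k} → Prime p → 0 < k → k < p → p ∣ p C k
  prime∣pCk {suc q} {suc k} p-prime _ k<p
    with euclidsLemma (suc k) (suc q C suc k) p-prime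
           (divides (q C k) (≡.trans ([k+1]*[n+1]C[k+1]≡[n+1]*nCk q k) (*-comm (suc q) _)))
  ... | inj₁ p∣k = contradiction (∣⇒≤ p∣k) (<⇒≱ k<p)
  ... | inj₂ p∣C = p∣C

open BinomialCoefficients using (prime∣pCk)

module CharacteristicSemiring {a ℓ} (S : Semiring a ℓ) where
  open Semiring S
  open import Algebra.Properties.Semiring.Mult S
  open import Algebra.Properties.Semiring.Exp S
  open import Algebra.Properties.Semiring.Sum S
  open import Relation.Binary.Reasoning.Setoid setoid

  ×-zeroʳ : ∀ n → n × 0# ≈ 0#
  ×-zeroʳ n = trans (sym (sum-replicate n)) (sum-replicate-zero n)

  ∣⇒×≈0# : ∀ {p n} → (∀ z → p × z ≈ 0#) → p ∣ n → ∀ x → n × x ≈ 0#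
  ∣⇒×≈0# {p} char (divides w ≡.refl) x = begin
    (w ℕ.* p) × x  ≈⟨ ×-assocˡ x w p ⟨
    w × (p × x)  ≈⟨ ×-congʳ w (char x) ⟩
    w × 0#       ≈⟨ ×-zeroʳ w ⟩
    0#           ∎

  frobenius : ∀ {p} → Prime p → (∀ z → p × z ≈ 0#) →
              ∀ {x y} → x * y ≈ y * x → (x + y) ^ p ≈ x ^ p + y ^ p
  frobenius {zero}  p-prime = contradiction p-prime ¬prime[0]
  frobenius {suc q} p-prime char {x} {y} xy≈yx = begin
    (x + y) ^ suc q                                   ≈⟨ theorem xy≈yx (suc q) ⟩
    t Fin.zero + sum (tail t)                         ≈⟨ +-cong first (sum-init-last (tail t)) ⟩
    y ^ suc q + (sum (init (tail t)) + last (tail t)) ≈⟨ +-congˡ (+-cong middle (lastTerm _ (≡.cong suc (toℕ-fromℕ q)))) ⟩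
    y ^ suc q + (0# + x ^ suc q)                      ≈⟨ +-congˡ (+-identityˡ _) ⟩
    y ^ suc q + x ^ suc q                             ≈⟨ +-comm _ _ ⟩
    x ^ suc q + y ^ suc q                             ∎
    where
    open Binomial S x y using (theorem; binomialTerm)
    t : Fin.Fin (suc (suc q)) → Carrier
    t = binomialTerm (suc q)
    first : t Fin.zero ≈ y ^ suc q
    first = trans (×-homo-1 _) (*-identityˡ _)
    middle : sum (init (tail t)) ≈ 0#
    middle = trans (sum-cong-≋ (λ i → ∣⇒×≈0# char (prime∣pCk p-prime (s≤s z≤n) (s≤s (inject₁ℕ< i))) _))
                   (sum-replicate-zero q)
    lastTerm : ∀ k → k ≡ suc q → (suc q C k) × (x ^ k * y ^ (suc q ∸ k)) ≈ x ^ suc q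
    lastTerm k ≡.refl rewrite nCn≡1 (suc q) | n∸n≡0 q = trans (×-homo-1 _) (*-identityʳ _)

  1#^≈1# : ∀ n → 1# ^ n ≈ 1#
  1#^≈1# zero    = refl
  1#^≈1# (suc n) = trans (*-identityˡ _) (1#^≈1# n)

  frobenius-+1# : ∀ {p} → Prime p → (∀ z → p × z ≈ 0#) →
                  ∀ j x → (x + 1#) ^ (p ℕ.^ j) ≈ x ^ (p ℕ.^ j) + 1#
  frobenius-+1# p-prime char zero    x = trans (*-identityʳ _) (+-congʳ (sym (*-identityʳ x)))
  frobenius-+1# {p} p-prime char (suc j) x = begin
    (x + 1#) ^ (p ℕ.* q)          ≈⟨ [z^q]^p≈z^[p*q] (x + 1#) ⟨
    ((x + 1#) ^ q) ^ p            ≈⟨ ^-congˡ p (frobenius-+1# p-prime char j x) ⟩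
    (x ^ q + 1#) ^ p              ≈⟨ frobenius p-prime char (trans (*-identityʳ _) (sym (*-identityˡ _))) ⟩
    (x ^ q) ^ p + 1# ^ p          ≈⟨ +-cong ([z^q]^p≈z^[p*q] x) (1#^≈1# p) ⟩
    x ^ (p ℕ.* q) + 1#            ∎
    where
    q : ℕ
    q = p ℕ.^ j
    [z^q]^p≈z^[p*q] : ∀ z → (z ^ q) ^ p ≈ z ^ (p ℕ.* q)
    [z^q]^p≈z^[p*q] z = trans (^-assocʳ z q p) (^-congʳ z (*-comm q p))

module Endomorphisms {c ℓ} (A : AbelianGroup c ℓ) where
  open AbelianGroup A
  open import Algebra.Properties.AbelianGroup A using (identityˡ-unique; ⁻¹-∙-comm)
  open import Algebra.Properties.CommutativeSemigroup commutativeSemigroup using (interchange)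
  open import Relation.Binary.Reasoning.Setoid setoid

  times-cong : ∀ k {x y} → x ≈ y → times A k x ≈ times A k y
  times-cong zero    x≈y = refl
  times-cong (suc k) x≈y = ∙-cong x≈y (times-cong k x≈y)

  times-+ : ∀ a b x → times A (a ℕ.+ b) x ≈ times A a x ∙ times A b x
  times-+ zero    b x = sym (identityˡ _)
  times-+ (suc a) b x = trans (∙-congˡ (times-+ a b x)) (sym (assoc _ _ _))

  times-* : ∀ a b x → times A (a ℕ.* b) x ≈ times A a (times A b x)
  times-* zero    b x = refl
  times-* (suc a) b x = trans (times-+ b (a ℕ.* b) x) (∙-congˡ (times-* a b x))

  iter-times : ∀ n k x → iter (times A n) k x ≈ times A (n ℕ.^ k) x
  iter-times n zero    x = sym (identityʳ x)
  iter-times n (suc k) x = trans (times-cong n (iter-times n k x)) (sym (times-* n (n ℕ.^ k) x))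

  Torsion : ℕ → Pred Carrier ℓ
  Torsion k x = times A k x ≈ ε

  record Endomorphism : Set (c ⊔ ℓ) where
    field
      ⟦_⟧    : Carrier → Carrier
      ⟦⟧-cong : ∀ {x y} → x ≈ y → ⟦_⟧ x ≈ ⟦_⟧ y
      homo   : ∀ x y → ⟦_⟧ (x ∙ y) ≈ ⟦_⟧ x ∙ ⟦_⟧ y
  open Endomorphism public

  homo-ε : ∀ e → ⟦ e ⟧ ε ≈ ε
  homo-ε e = identityˡ-unique _ _ (sym (trans (⟦⟧-cong e (sym (identityˡ ε))) (homo e ε ε)))

  homo-times : ∀ e k x → ⟦ e ⟧ (times A k x) ≈ times A k (⟦ e ⟧ x)
  homo-times e zero    x = homo-ε e
  homo-times e (suc k) x = trans (homo e _ _) (∙-congˡ (homo-times e k x))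

  torsion-preserved : ∀ e k {x} → Torsion k x → Torsion k (⟦ e ⟧ x)
  torsion-preserved e k {x} tx = trans (sym (homo-times e k x)) (trans (⟦⟧-cong e tx) (homo-ε e))

  _+ᴱ_ : Endomorphism → Endomorphism → Endomorphism
  e +ᴱ e' = record
    { ⟦_⟧    = λ x → ⟦ e ⟧ x ∙ ⟦ e' ⟧ x
    ; ⟦⟧-cong = λ x≈y → ∙-cong (⟦⟧-cong e x≈y) (⟦⟧-cong e' x≈y)
    ; homo   = λ x y → trans (∙-cong (homo e x y) (homo e' x y)) (interchange _ _ _ _)
    }

  _*ᴱ_ : Endomorphism → Endomorphism → Endomorphism
  e *ᴱ e' = record
    { ⟦_⟧    = λ x → ⟦ e ⟧ (⟦ e' ⟧ x)
    ; ⟦⟧-cong = λ x≈y → ⟦⟧-cong e (⟦⟧-cong e' x≈y)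
    ; homo   = λ x y → trans (⟦⟧-cong e (homo e' x y)) (homo e _ _)
    }

  0ᴱ : Endomorphism
  0ᴱ = record { ⟦_⟧ = λ _ → ε ; ⟦⟧-cong = λ _ → refl ; homo = λ _ _ → sym (identityˡ ε) }

  1ᴱ : Endomorphism
  1ᴱ = record { ⟦_⟧ = λ x → x ; ⟦⟧-cong = λ x≈y → x≈y ; homo = λ _ _ → refl }

  -1ᴱ : Endomorphism
  -1ᴱ = record { ⟦_⟧ = _⁻¹ ; ⟦⟧-cong = ⁻¹-cong ; homo = λ x y → sym (⁻¹-∙-comm x y) }

  -- Identifying endomorphisms that agree on A[k] makes End[ k ] the image of End(A) in End(A[k]).
  _≗[_]_ : Endomorphism → ℕ → Endomorphism → Set (c ⊔ ℓ)
  e ≗[ k ] e' = ∀ {x} → Torsion k x → ⟦ e ⟧ x ≈ ⟦ e' ⟧ x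

  End[_] : ℕ → Semiring (c ⊔ ℓ) (c ⊔ ℓ)
  End[ k ] = record
    { Carrier = Endomorphism ; _≈_ = _≗[ k ]_ ; _+_ = _+ᴱ_ ; _*_ = _*ᴱ_ ; 0# = 0ᴱ ; 1# = 1ᴱ
    ; isSemiring = record
      { isSemiringWithoutAnnihilatingZero = record
        { +-isCommutativeMonoid = record
          { isMonoid = record
            { isSemigroup = record
              { isMagma = record
                { isEquivalence = record
                  { refl = λ _ → refl ; sym = λ e≗e' t → sym (e≗e' t) ; trans = λ e≗e' e'≗e'' t → trans (e≗e' t) (e'≗e'' t) }
                ; ∙-cong = λ e≗e' f≗f' t → ∙-cong (e≗e' t) (f≗f' t) }
              ; assoc = λ _ _ _ _ → assoc _ _ _ }
            ; identity = (λ _ _ → identityˡ _) , (λ _ _ → identityʳ _) }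
          ; comm = λ _ _ _ → comm _ _ }
        ; *-cong = λ {e} {e'} {f} {f'} e≗e' f≗f' t → trans (⟦⟧-cong e (f≗f' t)) (e≗e' (torsion-preserved f' k t))
        ; *-assoc = λ _ _ _ _ → refl
        ; *-identity = (λ _ _ → refl) , (λ _ _ → refl)
        ; distrib = (λ e _ _ _ → homo e _ _) , (λ _ _ _ _ → refl) }
      ; zero = (λ _ _ → refl) , (λ e _ → homo-ε e) } }

  module _ (k : ℕ) where
    open Semiring End[ k ] using () renaming (_≈_ to _≗_)
    open import Algebra.Properties.Semiring.Mult End[ k ] using (_×_)
    open import Algebra.Properties.Semiring.Exp End[ k ] using (_^_)

    ⟦×⟧ : ∀ n e x → ⟦ n × e ⟧ x ≈ times A n (⟦ e ⟧ x)
    ⟦×⟧ zero    e x = refl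
    ⟦×⟧ (suc n) e x = ∙-congˡ (⟦×⟧ n e x)

    ⟦^⟧ : ∀ n e x → ⟦ e ^ n ⟧ x ≈ iter ⟦ e ⟧ n x
    ⟦^⟧ zero    e x = refl
    ⟦^⟧ (suc n) e x = ⟦⟧-cong e (⟦^⟧ n e x)

    End-char : ∀ e → k × e ≗ 0ᴱ
    End-char e {x} tx = trans (⟦×⟧ k e x) (torsion-preserved e k tx)

module _ {a ℓ r} {X : Set a} (_≈_ : Rel X ℓ) (o : X) (P : Pred X r) where

  TrivialKernelOn : (X → X) → Set (a ⊔ ℓ ⊔ r)
  TrivialKernelOn f = ∀ {x} → P x → f x ≈ o → x ≈ o

  iter-trivialKernelOn : ∀ {f} → (∀ {x} → P x → P (f x)) → TrivialKernelOn f →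
                         ∀ k → TrivialKernelOn (iter f k)
  iter-trivialKernelOn {f} f-closed f-kernel zero    px x≈o   = x≈o
  iter-trivialKernelOn {f} f-closed f-kernel (suc k) px fᵏ⁺¹x≈o =
    iter-trivialKernelOn f-closed f-kernel k px (f-kernel (iter-closed k px) fᵏ⁺¹x≈o)
    where
    iter-closed : ∀ k {x} → P x → P (iter f k x)
    iter-closed zero    px = px
    iter-closed (suc k) px = f-closed (iter-closed k px)

module _ {p m i c ℓ} (M : RmGiModule p m i c ℓ) where
  open RmGiModule M
  open Endomorphisms abGroup
  open import Algebra.Properties.AbelianGroup abGroup using (identityˡ-unique; x∙y⁻¹≈ε⇒x≈y)
  open import Relation.Binary.Reasoning.Setoid setoid

  ∩-isSubmodule : ∀ {r} {N₁ N₂ : Pred Carrier r} →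
                  IsSubmodule M N₁ → IsSubmodule M N₂ → IsSubmodule M (N₁ ∩ N₂)
  ∩-isSubmodule S₁ S₂ = record
    { resp-≈ = λ x≈y (x₁ , x₂) → S₁.resp-≈ x≈y x₁ , S₂.resp-≈ x≈y x₂
    ; ε-mem  = S₁.ε-mem , S₂.ε-mem
    ; ∙-mem  = λ (x₁ , x₂) (y₁ , y₂) → S₁.∙-mem x₁ y₁ , S₂.∙-mem x₂ y₂
    ; ⁻¹-mem = λ (x₁ , x₂) → S₁.⁻¹-mem x₁ , S₂.⁻¹-mem x₂
    ; σ-mem  = λ (x₁ , x₂) → S₁.σ-mem x₁ , S₂.σ-mem x₂
    }
    where
    module S₁ = IsSubmodule S₁
    module S₂ = IsSubmodule S₂

  σᴱ : Endomorphism
  σᴱ = record { ⟦_⟧ = σ ; ⟦⟧-cong = σ-cong ; homo = σ-hom }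

  Δ : Endomorphism
  Δ = σᴱ +ᴱ -1ᴱ

  module _ {r} {N : Pred Carrier r} (N-sub : IsSubmodule M N) where
    open IsSubmodule N-sub

    times-mem : ∀ k {x} → x ∈ N → times abGroup k x ∈ N
    times-mem zero    x∈N = ε-mem
    times-mem (suc k) x∈N = ∙-mem x∈N (times-mem k x∈N)

    Δ-mem : ∀ {x} → x ∈ N → ⟦ Δ ⟧ x ∈ N
    Δ-mem x∈N = ∙-mem (σ-mem x∈N) (⁻¹-mem x∈N)

  module _ (p-prime : Prime p) where
    open CharacteristicSemiring End[ p ] using (frobenius-+1#)
    open Semiring End[ p ] using () renaming (_≈_ to _≗_)
    open import Algebra.Properties.Semiring.Exp End[ p ] using (_^_; ^-congˡ)

    Δ+1≗σ : Δ +ᴱ 1ᴱ ≗ σᴱ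
    Δ+1≗σ {x} _ = begin
      (σ x ∙ x ⁻¹) ∙ x  ≈⟨ assoc _ _ _ ⟩
      σ x ∙ (x ⁻¹ ∙ x)  ≈⟨ ∙-congˡ (inverseˡ x) ⟩
      σ x ∙ ε           ≈⟨ identityʳ _ ⟩
      σ x               ∎

    Δ^p^i-kills-torsion : ∀ {x} → Torsion p x → ⟦ Δ ^ (p ℕ.^ i) ⟧ x ≈ ε
    Δ^p^i-kills-torsion {x} tx = identityˡ-unique _ _ (begin
      ⟦ Δ ^ K ⟧ x ∙ x       ≈⟨ frobenius-+1# p-prime (End-char p) i Δ tx ⟨
      ⟦ (Δ +ᴱ 1ᴱ) ^ K ⟧ x   ≈⟨ ^-congˡ K Δ+1≗σ tx ⟩
      ⟦ σᴱ ^ K ⟧ x          ≈⟨ ⟦^⟧ p K σᴱ x ⟩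
      iter σ K x            ≈⟨ σ-order x ⟩
      x                     ∎)
      where
      K : ℕ
      K = p ℕ.^ i

    module _ {r} {N : Pred Carrier r} (N-sub : IsSubmodule M N)
             (star-trivial : ∀ x → x ∈ star M N → x ≈ ε) where

      star-trivial⇒torsion-trivial : ∀ {x} → x ∈ N → Torsion p x → x ≈ ε
      star-trivial⇒torsion-trivial {x} x∈N tx =
        iter-trivialKernelOn _≈_ ε (N ∩ Torsion p) Δ-closed Δ-kernel K (x∈N , tx)
          (trans (sym (⟦^⟧ p K Δ x)) (Δ^p^i-kills-torsion tx))
        where
        K : ℕ
        K = p ℕ.^ i
        Δ-closed : ∀ {z} → z ∈ N ∩ Torsion p → ⟦ Δ ⟧ z ∈ N ∩ Torsion p
        Δ-closed (z∈N , tz) = Δ-mem N-sub z∈N , torsion-preserved Δ p tz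
        Δ-kernel : TrivialKernelOn _≈_ ε (N ∩ Torsion p) ⟦ Δ ⟧
        Δ-kernel (z∈N , tz) Δz≈ε = star-trivial _ (z∈N , tz , x∙y⁻¹≈ε⇒x≈y _ _ Δz≈ε)

      star-trivial⇒trivial : ∀ {x} → x ∈ N → x ≈ ε
      star-trivial⇒trivial {x} x∈N =
        iter-trivialKernelOn _≈_ ε N (times-mem N-sub p) star-trivial⇒torsion-trivial m x∈N
          (trans (iter-times p m x) (char x))

-- The bound i ≤ n only records that G_i is a quotient of G; the argument never uses it.
lemma3p3 : ∀ {c ℓ r : Level} (p n m i : ℕ) → Prime p → i ≤ n →
    (M : RmGiModule p m i c ℓ) →
    (M₁ M₂ : Pred (RmGiModule.Carrier M) r) →
    IsSubmodule M M₁ → IsSubmodule M M₂ →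
    (∀ x → x ∈ star M M₁ → x ∈ star M M₂ → RmGiModule._≈_ M x (RmGiModule.ε M)) →
    IsDirectSum M M₁ M₂
lemma3p3 p n m i p-prime _ M M₁ M₂ M₁-sub M₂-sub stars-disjoint x x∈M₁ x∈M₂ =
  star-trivial⇒trivial M p-prime (∩-isSubmodule M M₁-sub M₂-sub) star-∩-trivial (x∈M₁ , x∈M₂)
  where
  star-∩-trivial : ∀ y → y ∈ star M (M₁ ∩ M₂) → RmGiModule._≈_ M y (RmGiModule.ε M)
  star-∩-trivial y ((y∈M₁ , y∈M₂) , py≈ε , σy≈y) = stars-disjoint y (y∈M₁ , py≈ε , σy≈y) (y∈M₂ , py≈ε , σy≈y)
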